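{- Let $C=(V,E)$ be an undirected cycle with two commodities given by vertex pairs $\{s_1,t_1\}$ and $\{s_2,t_2\}$ with $s_1\ne t_1$, $s_2\ne t_2$, and demands $r_1>0$, $r_2>0$; write $\mathbf r=(r_1,r_2)$. For $i\in\{1,2\}$ let $P_i$ be the set of $s_i$–$t_i$ paths in $C$, and let $P=P_1\cup P_2$. Let $f,f'$ be two feasible flows for $(C,(s_i,t_i)_{i=1,2},\mathbf r)$, i.e. each assigns a value $f(p)\ge 0$ (resp. $f'(p)\ge0$) to every path $p\in P_i$ of commodity $i$, with $\sum_{p\in P_i}f(p)=\sum_{p\in P_i}f'(p)=r_i$ for $i=1,2$. For each edge $e\in E$ let $f(e)$ (resp. $f'(e)$) be the total amount of flow, summed over both commodities, on all paths containing $e$. Then there exist $i\in\{1,2\}$ and a path $p\in P_i$ with $f(p)>0$ such that $f(e)\ge f'(e)$ for every edge $e\in p$.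
   Context: Paths are simple paths in the cycle; for each $i$, $P_i$ consists of exactly two edge-disjoint $s_i$–$t_i$ paths. The flow values of the two commodities are kept separate: if the same path of $C$ serves both commodities (e.g. when $\{s_1,t_1\}=\{s_2,t_2\}$), it carries a commodity-1 value and a commodity-2 value, and the edge load is $f(e)=\sum_{i=1}^{2}\sum_{p\in P_i,\ e\in p}f(p)$, similarly for $f'$. "$e\in p$" means the edge $e$ lies on the path $p$.
   Formalization: The demands $r_1$, $r_2$ and the path values of the feasible flows $f,f'$ are rational numbers instead of reals. -}

module Defs where

open import Data.Nat using (ℕ; _+_; _∸_; _≤ᵇ_; _<ᵇ_)
open import Data.Fin using (Fin; toℕ; zero; suc)
open import Data.Bool using (Bool; true; false; not; if_then_else_)
open import Data.Rational using (ℚ; 0ℚ) renaming (_+_ to _+ℚ_)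

-- The cycle C_n has vertices Fin n (n ≥ 3 assumed in the theorem) and
-- edges Fin n, where edge e joins vertex e and vertex e+1 (mod n).

offset : (n : ℕ) → Fin n → Fin n → ℕ
offset n a b = if toℕ a ≤ᵇ toℕ b then toℕ b ∸ toℕ a else (n + toℕ b) ∸ toℕ a

-- For s ≠ t the two simple s–t paths of the cycle are the clockwise one
-- (direction true: edges s, s+1, ..., t-1) and the counter-clockwise one
-- (direction false: all remaining edges).  onPath n s t d e : edge e lies on path d.
onPath : (n : ℕ) → Fin n → Fin n → Bool → Fin n → Bool
onPath n s t true  e = offset n s e <ᵇ offset n s t
onPath n s t false e = not (offset n s e <ᵇ offset n s t)

Flow : Set
Flow = Fin 2 → Bool → ℚ

contrib : (n : ℕ) → (Fin 2 → Fin n) → (Fin 2 → Fin n) → Flow → Fin 2 → Bool → Fin n → ℚ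
contrib n s t f i d e = if onPath n (s i) (t i) d e then f i d else 0ℚ

load : (n : ℕ) → (Fin 2 → Fin n) → (Fin 2 → Fin n) → Flow → Fin n → ℚ
load n s t f e =
  (contrib n s t f zero true e +ℚ contrib n s t f zero false e) +ℚ
  (contrib n s t f (suc zero) true e +ℚ contrib n s t f (suc zero) false e)

-- Commodity i contributes to edge e the flow of whichever of its two paths contains e, so
-- load f e = f₀(c₀) + f₁(c₁) for the route c of e; nothing else about the cycle matters.
-- Let gᵢ(d) = fᵢ(d) − f′ᵢ(d).  Equal demands give gᵢ(¬d) = −gᵢ(d), so every commodity has a
-- side with nonnegative gain, and the commodity i whose such gain gᵢ(d) is the larger has
-- gᵢ(d) + gⱼ(b) ≥ 0 for both b: every edge of path d of commodity i carries at least as much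
-- under f as under f′.  If gᵢ(d) > 0 then fᵢ(d) > f′ᵢ(d) ≥ 0; otherwise gᵢ vanishes on both
-- paths, both paths of i qualify, and one of them carries positive flow because rᵢ > 0.
module Submission where

open import Defs
open import Data.Nat using (ℕ)
open import Data.Fin using (Fin; zero; suc; opposite)
open import Data.Bool using (Bool; true; false; not; T)
open import Data.Bool.Properties using (¬-not; T-≡; T-not-≡) renaming (_≟_ to _≟ᵇ_)
open import Data.Product using (Σ; _×_; _,_)
open import Data.Sum using (_⊎_; inj₁; inj₂)
open import Data.Rational using (ℚ; 0ℚ; _≤_; _<_; _+_; _-_; -_)
open import Data.Rational.Properties
  using (≤-antisym; ≤-total; ≮⇒≥; <-irrefl; <-≤-trans; ≤-<-trans; _<?_; module ≤-Reasoning;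
         +-comm; +-identityˡ; +-identityʳ; +-inverseʳ; +-mono-≤; +-monoˡ-≤; +-monoˡ-<;
         neg-antimono-≤)
open import Data.Rational.Solver using (module +-*-Solver)
open import Function.Bundles using (Equivalence)
open import Relation.Nullary using (yes; no; contradiction)
open import Relation.Binary.PropositionalEquality
  using (_≡_; _≢_; refl; sym; trans; cong; cong₂; subst; subst₂; module ≡-Reasoning)

module _ where
  open +-*-Solver

  sub-+-sub : ∀ a b a′ b′ → (a + b) - (a′ + b′) ≡ (a - a′) + (b - b′)
  sub-+-sub = solve 4 (λ a b a′ b′ → (a :+ b) :- (a′ :+ b′) := (a :- a′) :+ (b :- b′))
                      refl

  sub-+-cancel : ∀ p q → (q - p) + p ≡ q
  sub-+-cancel = solve 2 (λ p q → (q :- p) :+ p := q) refl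

  sub-≡-neg-sub : ∀ x y x′ y′ → x + y ≡ x′ + y′ → y - y′ ≡ - (x - x′)
  sub-≡-neg-sub x y x′ y′ eq = begin
    y - y′               ≡⟨ solve 3 (λ x y y′ → y :- y′ := (x :+ y) :- (x :+ y′)) refl x y y′ ⟩
    (x + y) - (x + y′)   ≡⟨ cong (_- (x + y′)) eq ⟩
    (x′ + y′) - (x + y′) ≡⟨ solve 3 (λ x x′ y′ → (x′ :+ y′) :- (x :+ y′) := :- (x :- x′))
                                   refl x x′ y′ ⟩
    - (x - x′)           ∎
    where open ≡-Reasoning

p≤q⇒0≤q-p : ∀ {p q} → p ≤ q → 0ℚ ≤ q - p
p≤q⇒0≤q-p {p} {q} p≤q = begin
  0ℚ    ≡⟨ sym (+-inverseʳ p) ⟩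
  p - p ≤⟨ +-monoˡ-≤ (- p) p≤q ⟩
  q - p ∎
  where open ≤-Reasoning

0≤q-p⇒p≤q : ∀ {p q} → 0ℚ ≤ q - p → p ≤ q
0≤q-p⇒p≤q {p} {q} 0≤q-p = begin
  p           ≡⟨ sym (+-identityˡ p) ⟩
  0ℚ + p      ≤⟨ +-monoˡ-≤ p 0≤q-p ⟩
  (q - p) + p ≡⟨ sub-+-cancel p q ⟩
  q           ∎
  where open ≤-Reasoning

0<q-p⇒p<q : ∀ {p q} → 0ℚ < q - p → p < q
0<q-p⇒p<q {p} {q} 0<q-p = begin-strict
  p           ≡⟨ sym (+-identityˡ p) ⟩
  0ℚ + p      <⟨ +-monoˡ-< p 0<q-p ⟩
  (q - p) + p ≡⟨ sub-+-cancel p q ⟩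
  q           ∎
  where open ≤-Reasoning

0<p+q⇒0<p⊎0<q : ∀ p q → 0ℚ < p + q → 0ℚ < p ⊎ 0ℚ < q
0<p+q⇒0<p⊎0<q p q 0<p+q with 0ℚ <? p | 0ℚ <? q
... | yes 0<p | _       = inj₁ 0<p
... | no _    | yes 0<q = inj₂ 0<q
... | no 0≮p  | no 0≮q  =
  contradiction (<-≤-trans 0<p+q (+-mono-≤ (≮⇒≥ 0≮p) (≮⇒≥ 0≮q))) (<-irrefl refl)

gain : Flow → Flow → Flow
gain f f′ i d = f i d - f′ i d

Balanced : Flow → Set
Balanced g = ∀ i d → g i (not d) ≡ - g i d

Dominant : Flow → Fin 2 → Bool → Set
Dominant g i d = ∀ b → 0ℚ ≤ g i d + g (opposite i) b

gain-balanced : ∀ f f′ → (∀ i → f i true + f i false ≡ f′ i true + f′ i false) →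
                Balanced (gain f f′)
gain-balanced f f′ same i true  = sub-≡-neg-sub (f i true) (f i false) (f′ i true) (f′ i false) (same i)
gain-balanced f f′ same i false = sub-≡-neg-sub (f i false) (f i true) (f′ i false) (f′ i true) same′
  where
  same′ : f i false + f i true ≡ f′ i false + f′ i true
  same′ = trans (+-comm (f i false) (f i true)) (trans (same i) (+-comm (f′ i true) (f′ i false)))

nonNegative-side : ∀ g → Balanced g → ∀ i → Σ Bool λ d → 0ℚ ≤ g i d
nonNegative-side g bal i with ≤-total 0ℚ (g i true)
... | inj₁ 0≤g = true , 0≤g
... | inj₂ g≤0 = false , subst (0ℚ ≤_) (sym (bal i true)) (neg-antimono-≤ g≤0)

larger-gain-dominant : ∀ g → Balanced g → ∀ {i d d′} →
                       0ℚ ≤ g i d → 0ℚ ≤ g (opposite i) d′ → g (opposite i) d′ ≤ g i d →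
                       Dominant g i d
larger-gain-dominant g bal {i} {d} {d′} 0≤gᵢ 0≤gⱼ gⱼ≤gᵢ b with b ≟ᵇ d′
... | yes refl = +-mono-≤ 0≤gᵢ 0≤gⱼ
... | no b≢d′ rewrite ¬-not b≢d′ | bal (opposite i) d′ = p≤q⇒0≤q-p gⱼ≤gᵢ

dominant-side : ∀ g → Balanced g → Σ (Fin 2) λ i → Σ Bool λ d → 0ℚ ≤ g i d × Dominant g i d
dominant-side g bal with nonNegative-side g bal zero | nonNegative-side g bal (suc zero)
... | d₀ , 0≤g₀ | d₁ , 0≤g₁ with ≤-total (g zero d₀) (g (suc zero) d₁)
... | inj₁ g₀≤g₁ = suc zero , d₁ , 0≤g₁ , larger-gain-dominant g bal 0≤g₁ 0≤g₀ g₀≤g₁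
... | inj₂ g₁≤g₀ = zero , d₀ , 0≤g₀ , larger-gain-dominant g bal 0≤g₀ 0≤g₁ g₁≤g₀

balanced-zero : ∀ g → Balanced g → ∀ {i d} → g i d ≡ 0ℚ → ∀ b → g i b ≡ 0ℚ
balanced-zero g bal {i} {d} gd≡0 b with b ≟ᵇ d
... | yes refl = gd≡0
... | no b≢d rewrite ¬-not b≢d | bal i d | gd≡0 = refl

zero-gain-dominant : ∀ g → Balanced g → ∀ {i d} → g i d ≡ 0ℚ → Dominant g i d →
                     ∀ b → Dominant g i b
zero-gain-dominant g bal {i} gd≡0 dom b b′ = subst (λ x → 0ℚ ≤ x + g (opposite i) b′)
  (trans gd≡0 (sym (balanced-zero g bal gd≡0 b))) (dom b′)

positive-side : ∀ (h : Bool → ℚ) → 0ℚ < h true + h false → Σ Bool λ b → 0ℚ < h b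
positive-side h 0<h with 0<p+q⇒0<p⊎0<q (h true) (h false) 0<h
... | inj₁ 0<h₁ = true , 0<h₁
... | inj₂ 0<h₀ = false , 0<h₀

positive-dominant-path : ∀ f f′ → (∀ i d → 0ℚ ≤ f′ i d) →
  (∀ i → f i true + f i false ≡ f′ i true + f′ i false) →
  (∀ i → 0ℚ < f i true + f i false) →
  Σ (Fin 2) λ i → Σ Bool λ d → 0ℚ < f i d × Dominant (gain f f′) i d
positive-dominant-path f f′ f′≥0 same demand>0
  with bal ← gain-balanced f f′ same
  with i , d , 0≤g , dom ← dominant-side (gain f f′) bal
  with 0ℚ <? gain f f′ i d
... | yes 0<g = i , d , ≤-<-trans (f′≥0 i d) (0<q-p⇒p<q 0<g) , dom
... | no 0≮g with b , 0<fb ← positive-side (f i) (demand>0 i) =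
  i , b , 0<fb , zero-gain-dominant (gain f f′) bal (≤-antisym (≮⇒≥ 0≮g) 0≤g) dom b

route : (n : ℕ) → (Fin 2 → Fin n) → (Fin 2 → Fin n) → Fin n → Fin 2 → Bool
route n s t e i = onPath n (s i) (t i) true e

routedLoad : Flow → (Fin 2 → Bool) → ℚ
routedLoad g c = g zero (c zero) + g (suc zero) (c (suc zero))

onPath⇒route : ∀ n s t i d e → T (onPath n (s i) (t i) d e) → route n s t e i ≡ d
onPath⇒route n s t i true  e = Equivalence.to T-≡
onPath⇒route n s t i false e = Equivalence.to T-not-≡

contrib-pair : ∀ n s t f i e →
               contrib n s t f i true e + contrib n s t f i false e ≡ f i (route n s t e i)
contrib-pair n s t f i e with route n s t e i
... | true  = +-identityʳ (f i true)
... | false = +-identityˡ (f i false)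

load-routed : ∀ n s t f e → load n s t f e ≡ routedLoad f (route n s t e)
load-routed n s t f e =
  cong₂ _+_ (contrib-pair n s t f zero e) (contrib-pair n s t f (suc zero) e)

routedLoad-opposite : ∀ g c i → routedLoad g c ≡ g i (c i) + g (opposite i) (c (opposite i))
routedLoad-opposite g c zero       = refl
routedLoad-opposite g c (suc zero) = +-comm (g zero (c zero)) (g (suc zero) (c (suc zero)))

routedLoad-gain : ∀ f f′ c → routedLoad f c - routedLoad f′ c ≡ routedLoad (gain f f′) c
routedLoad-gain f f′ c = sub-+-sub (f zero (c zero)) (f (suc zero) (c (suc zero)))
                                   (f′ zero (c zero)) (f′ (suc zero) (c (suc zero)))

dominant⇒routedLoad≤ : ∀ f f′ c {i} → Dominant (gain f f′) i (c i) →
                       routedLoad f′ c ≤ routedLoad f c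
dominant⇒routedLoad≤ f f′ c {i} dom = 0≤q-p⇒p≤q (subst (0ℚ ≤_) (sym gain≡) (dom (c (opposite i))))
  where
  gain≡ : routedLoad f c - routedLoad f′ c ≡
          gain f f′ i (c i) + gain f f′ (opposite i) (c (opposite i))
  gain≡ = trans (routedLoad-gain f f′ c) (routedLoad-opposite (gain f f′) c i)

theorem2p2 : (n : ℕ) → 3 Data.Nat.≤ n →
    (s t : Fin 2 → Fin n) → (∀ i → s i ≢ t i) →
    (r : Fin 2 → ℚ) → (∀ i → 0ℚ < r i) →
    (f f′ : Flow) →
    (∀ i d → 0ℚ ≤ f i d) → (∀ i → f i true + f i false ≡ r i) →
    (∀ i d → 0ℚ ≤ f′ i d) → (∀ i → f′ i true + f′ i false ≡ r i) →
    Σ (Fin 2) λ i → Σ Bool λ d →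
      (0ℚ < f i d) ×
      (∀ e → T (onPath n (s i) (t i) d e) → load n s t f′ e ≤ load n s t f e)
theorem2p2 n _ s t _ r r>0 f f′ _ f-demand f′≥0 f′-demand
  with i , d , 0<f , dom ← positive-dominant-path f f′ f′≥0
         (λ i → trans (f-demand i) (sym (f′-demand i)))
         (λ i → subst (0ℚ <_) (sym (f-demand i)) (r>0 i))
  = i , d , 0<f , load≤
  where
  load≤ : ∀ e → T (onPath n (s i) (t i) d e) → load n s t f′ e ≤ load n s t f e
  load≤ e e∈p = subst₂ _≤_ (sym (load-routed n s t f′ e)) (sym (load-routed n s t f e))
    (dominant⇒routedLoad≤ f f′ (route n s t e)
      (subst (Dominant (gain f f′) i) (sym (onPath⇒route n s t i d e e∈p)) dom))
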